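{- For every $n\ge1$ and $\pi\in\mathfrak{B}_n$, \[\mathcal{D}_B(\pi)=\sum_{\substack{E\subseteq\{0,\dots,n-1\}\\ \mathrm{Pe}_B(\pi)\subseteq E\cup(E+1)\\ \pi(1)<0\ \Rightarrow\ 0\in E}}2^{|E|}N_E.\]
   Context: $\mathfrak{B}_n$: signed permutations, bijections $\pi$ of $\{ -n,\dots,n\}$ with $\pi(-i)=-\pi(i)$, $\pi(0)=0$. $\mathrm{Des}_B(\pi)=\{i\in\{0,\dots,n-1\}:\pi(i)>\pi(i+1)\}$; $\mathrm{Pe}_B(\pi)=\{i\in\{1,\dots,n-1\}:\pi(i-1)<\pi(i)>\pi(i+1)\}$. For a set $E$ of integers, $E+1=\{e+1:e\in E\}$. Let $T_\infty=\{0,1^{ -1},1,2^{ -1},2,\dots\}$ be totally ordered as listed, with $\varepsilon(0)=\varepsilon(j)=1$, $\varepsilon(j^{ -1})=-1$, and $|0|=0$, $|j|=|j^{ -1}|=j$. Write $a\le^+b$ if $a<b$ or ($a=b$, $\varepsilon(a)=1$), $a\le^-b$ if $a<b$ or ($a=b$, $\varepsilon(a)=-1$). With commuting indeterminates $z_0,z_1,z_2,\dots$, $\mathcal{D}_B(\pi)=\sum\prod_{s=1}^n z_{|a_s|}$, the sum over all $(a_1,\dots,a_n)\in T_\infty^n$ such that, with $a_0=0$, for each $s\in\{0,\dots,n-1\}$, $a_s\le^+a_{s+1}$ if $s\notin\mathrm{Des}_B(\pi)$ and $a_s\le^-a_{s+1}$ if $s\in\mathrm{Des}_B(\pi)$.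 For $S=\{s_1<\dots<s_m\}\subseteq\{0,\dots,n-1\}$ (with $s_{m+1}:=n$), the type B monomial quasisymmetric function is $N_S=\sum_{0<i_1<\dots<i_m}z_0^{s_1}\prod_{r=1}^m z_{i_r}^{s_{r+1}-s_r}$ (so $N_\emptyset=z_0^n$). -}

module Defs where

open import Data.Nat using (ℕ; zero; suc; _+_; _*_; _∸_; _^_; _≤_; _<ᵇ_; _≡ᵇ_)
import Data.Nat as ℕ
open import Data.Integer as ℤ using (ℤ; ∣_∣)
open import Data.Fin using (Fin; toℕ; fromℕ<)
open import Data.Bool using (Bool; true; false; _∧_; _∨_; not; if_then_else_)
open import Data.List using (List; []; _∷_; _++_; replicate; map; concat; concatMap; upTo; length)
open import Data.Vec using (Vec; tabulate)
import Data.Vec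
import Data.Vec.Properties as VecP
import Data.List
import Data.Bool.ListAction
open import Data.Product using (_×_)
open import Relation.Binary.PropositionalEquality using (_≡_)
open import Relation.Nullary using (does)

-- Signed permutations.  π ∈ 𝔅ₙ is determined by (π(1),…,π(n)) :
-- img i = π(i+1) for i : Fin n; the conditions say that i ↦ |π(i+1)|
-- is an injection {1..n} → {1..n} (hence a bijection).  The values on
-- negative arguments are forced by π(-i) = -π(i), and π(0) = 0.

record SignedPerm (n : ℕ) : Set where
  field
    img       : Fin n → ℤ
    abs-pos   : ∀ i → 1 ≤ ∣ img i ∣
    abs-bound : ∀ i → ∣ img i ∣ ≤ n
    abs-inj   : ∀ i j → ∣ img i ∣ ≡ ∣ img j ∣ → i ≡ j
open SignedPerm public

-- π(k) for k ∈ {0,…,n} (value 0 is returned outside this range; never used there)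
πval : ∀ {n} → SignedPerm n → ℕ → ℤ
πval π zero = ℤ.0ℤ
πval {n} π (suc k) with k ℕ.<? n
... | Relation.Nullary.yes k<n = img π (fromℕ< k<n)
... | Relation.Nullary.no _    = ℤ.0ℤ

_<ℤ_ : ℤ → ℤ → Bool
x <ℤ y = does (x ℤ.<? y)

desB : ∀ {n} → SignedPerm n → ℕ → Bool
desB {n} π s = (s <ᵇ n) ∧ (πval π (suc s) <ℤ πval π s)

peB : ∀ {n} → SignedPerm n → ℕ → Bool
peB {n} π zero = false
peB {n} π (suc k) = (suc k <ᵇ n) ∧ (πval π k <ℤ πval π (suc k))
                                  ∧ (πval π (suc (suc k)) <ℤ πval π (suc k))

-- The totally ordered alphabet T∞ = {0, 1⁻¹, 1, 2⁻¹, 2, …}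

data T : Set where
  t0   : T
  tneg : ℕ → T      -- tneg j = (j+1)⁻¹
  tpos : ℕ → T      -- tpos j = j+1

absT : T → ℕ
absT t0       = 0
absT (tneg j) = suc j
absT (tpos j) = suc j

εpos : T → Bool
εpos t0       = true
εpos (tneg _) = false
εpos (tpos _) = true

rank : T → ℕ
rank t0       = 0
rank (tneg j) = suc (2 * j)
rank (tpos j) = suc (suc (2 * j))

_<T_ : T → T → Bool
a <T b = rank a <ᵇ rank b

_≡T_ : T → T → Bool
t0     ≡T t0     = true
tneg i ≡T tneg j = i ≡ᵇ j
tpos i ≡T tpos j = i ≡ᵇ j
_      ≡T _      = false

_≤⁺_ : T → T → Bool
a ≤⁺ b = (a <T b) ∨ ((a ≡T b) ∧ εpos a)

_≤⁻_ : T → T → Bool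
a ≤⁻ b = (a <T b) ∨ ((a ≡T b) ∧ not (εpos a))

Tupto : ℕ → List T
Tupto K = t0 ∷ concatMap (λ j → tneg j ∷ tpos j ∷ []) (upTo K)

seqs : {A : Set} → List A → ℕ → List (List A)
seqs xs zero    = [] ∷ []
seqs xs (suc n) = concatMap (λ x → map (x ∷_) (seqs xs n)) xs

countB : {A : Set} → (A → Bool) → List A → ℕ
countB p []       = 0
countB p (x ∷ xs) = (if p x then 1 else 0) + countB p xs

-- exponent vector (e₀,…,e_K) of the monomial ∏_{x ∈ xs} z_x
-- (only meaningful when all x ≤ K, which is the case wherever it is used)
expo : (K : ℕ) → List ℕ → Vec ℕ (suc K)
expo K xs = tabulate (λ j → countB (λ x → toℕ j ≡ᵇ x) xs)

_≡V_ : ∀ {m} → Vec ℕ m → Vec ℕ m → Bool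
u ≡V v = does (VecP.≡-dec ℕ._≟_ u v)

-- the chain condition on (a₁,…,aₙ), with a₀ = 0:
-- validFrom π a_s s (a_{s+1} ∷ …)
validFrom : ∀ {n} → SignedPerm n → T → ℕ → List T → Bool
validFrom π prev s []       = true
validFrom π prev s (x ∷ xs) =
  (if desB π s then prev ≤⁻ x else prev ≤⁺ x) ∧ validFrom π x (suc s) xs

-- coefficient of the monomial z₀^{e₀}⋯z_K^{e_K} in 𝒟_B(π).
-- Every tuple contributing to this monomial has all |a_s| ≤ K, so it
-- suffices to enumerate tuples in (Tupto K)ⁿ.
coeffDB : ∀ {n} → SignedPerm n → (K : ℕ) → Vec ℕ (suc K) → ℕ
coeffDB {n} π K e =
  countB (λ a → validFrom π t0 0 a ∧ (expo K (map absT a) ≡V e)) (seqs (Tupto K) n)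

allSubsets : (n : ℕ) → List (Vec Bool n)
allSubsets zero    = Data.Vec.[] ∷ []
allSubsets (suc n) = concatMap (λ b → map (b Data.Vec.∷_) (allSubsets n)) (true ∷ false ∷ [])

memE : ∀ {n} → Vec Bool n → ℕ → Bool
memE Data.Vec.[]       _       = false
memE (b Data.Vec.∷ bs) zero    = b
memE (b Data.Vec.∷ bs) (suc k) = memE bs k

sizeE : ∀ {n} → Vec Bool n → ℕ
sizeE {n} E = countB (memE E) (upTo n)

elemsE : ∀ {n} → Vec Bool n → List ℕ
elemsE {n} E = Data.List.filterᵇ (memE E) (upTo n)

admissible : ∀ {n} → SignedPerm n → Vec Bool n → Bool
admissible {n} π E =
  Data.Bool.ListAction.and (map (λ i → not (peB π i) ∨ memE E i ∨ memE E (i ∸ 1)) (upTo n))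
  ∧ (not (πval π 1 <ℤ ℤ.0ℤ) ∨ memE E 0)

-- blocks (s_r ∷ s_{r+1} ∷ …) (i_r ∷ …) n : the variable indices of
-- ∏_{r} z_{i_r}^{s_{r+1}-s_r}, with s_{m+1} = n
blocks : List ℕ → List ℕ → ℕ → List ℕ
blocks (s ∷ s' ∷ ss) (i ∷ is) n = replicate (s' ∸ s) i ++ blocks (s' ∷ ss) is n
blocks (s ∷ [])      (i ∷ is) n = replicate (n ∸ s) i
blocks _             _        n = []

-- variable indices of z₀^{s₁} ∏_{r=1}^m z_{i_r}^{s_{r+1}-s_r}
-- (for S = ∅ this is z₀ⁿ)
termN : ℕ → List ℕ → List ℕ → List ℕ
termN n []            is = replicate n 0
termN n (s₁ ∷ ss)     is = replicate s₁ 0 ++ blocks (s₁ ∷ ss) is n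

strictIncPos : ℕ → List ℕ → Bool
strictIncPos prev []       = true
strictIncPos prev (i ∷ is) = (prev <ᵇ i) ∧ strictIncPos i is

-- coefficient of z₀^{e₀}⋯z_K^{e_K} in N_S, S given by its sorted elements ss.
-- Only tuples with all i_r ≤ K can contribute.
coeffN : ℕ → List ℕ → (K : ℕ) → Vec ℕ (suc K) → ℕ
coeffN n ss K e =
  countB (λ is → strictIncPos 0 is ∧ (expo K (termN n ss is) ≡V e))
         (seqs (upTo (suc K)) (length ss))

-- Read the word (a₁,…,aₙ) from the left and count its valid continuations;
-- on the other side, sum over the part of E not yet chosen. Both satisfy the
-- same recursion in the number of remaining positions once the states are
-- matched: after the letter 0 or j, the continuations correspond to the
-- subsets for which a descent at the next position would be an uncovered peak,
-- and after j⁻¹ and after j together they number twice the subsets without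
-- that constraint. A step to a larger absolute value is a position of E, and
-- its two signs give the factor 2. Nothing depends on which monomial is
-- counted, so the identity is proved for any predicate on the word of
-- absolute values.

module Submission where

open import Defs
open import Data.Bool using (Bool; true; false; _∧_; _∨_; not; if_then_else_)
open import Data.Bool.ListAction using (and)
open import Data.Bool.Properties using (∧-assoc; ∧-comm; ∨-comm; ∨-identityʳ; ∧-identityʳ; ∧-zeroʳ; T-≡)
open import Data.Empty using (⊥-elim)
open import Data.Fin using (toℕ; fromℕ<)
open import Data.Fin.Properties using (toℕ-fromℕ<)
open import Data.Integer as ℤ using (∣_∣)
import Data.Integer.Properties as ℤ
open import Data.List using (List; []; _∷_; _++_; replicate; map; concatMap; upTo; applyUpTo; length; filterᵇ)
open import Data.List.Properties using (map-++; map-cong; map-∘; map-applyUpTo; map-upTo; length-map)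
open import Data.Nat using (ℕ; zero; suc; _+_; _*_; _^_; _≤_; _<_; _<ᵇ_; _≡ᵇ_; z<s; s<s)
import Data.Nat as ℕ
open import Data.Nat.ListAction using (sum)
open import Data.Nat.ListAction.Properties using (sum-++)
open import Data.Nat.Properties
  using (+-identityʳ; +-comm; +-suc; *-zeroʳ; *-assoc; *-distribˡ-+; <-trans; n<1+n; 1+n≢n; 1+n≰n; <⇒<ᵇ; +-commutativeSemigroup)
open import Algebra.Properties.CommutativeSemigroup +-commutativeSemigroup
  using (interchange)
open import Data.Nat.Tactic.RingSolver using (solve-∀)
open import Data.Vec using (Vec; []; _∷_)
open import Function using (_∘_; Equivalence)
open import Relation.Binary.Definitions using (tri<; tri≈; tri>)
open import Relation.Binary.PropositionalEquality
open import Relation.Nullary using (yes; no)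
open import Relation.Nullary.Decidable using (dec-true; dec-false)

private
  variable
    A B : Set
    m : ℕ

open ≡-Reasoning

sum-map-++ : (f : A → ℕ) (xs ys : List A) → sum (map f (xs ++ ys)) ≡ sum (map f xs) + sum (map f ys)
sum-map-++ f xs ys = trans (cong sum (map-++ f xs ys)) (sum-++ (map f xs) (map f ys))

sum-map-concatMap : (f : B → ℕ) (g : A → List B) (xs : List A) →
  sum (map f (concatMap g xs)) ≡ sum (map (λ x → sum (map f (g x))) xs)
sum-map-concatMap f g []       = refl
sum-map-concatMap f g (x ∷ xs) =
  trans (sum-map-++ f (g x) (concatMap g xs)) (cong (sum (map f (g x)) +_) (sum-map-concatMap f g xs))

sum-map-zero : (xs : List A) → sum (map (λ _ → 0) xs) ≡ 0
sum-map-zero []       = refl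
sum-map-zero (x ∷ xs) = sum-map-zero xs

sum-map-if : (b : Bool) (f : A → ℕ) (xs : List A) →
  sum (map (λ x → if b then f x else 0) xs) ≡ (if b then sum (map f xs) else 0)
sum-map-if true  f xs = refl
sum-map-if false f xs = sum-map-zero xs

sum-map-* : (c : ℕ) (f : A → ℕ) (xs : List A) → sum (map (λ x → c * f x) xs) ≡ c * sum (map f xs)
sum-map-* c f []       = sym (*-zeroʳ c)
sum-map-* c f (x ∷ xs) = trans (cong (c * f x +_) (sum-map-* c f xs)) (sym (*-distribˡ-+ c (f x) _))

sum-map-+ : (f g : A → ℕ) (xs : List A) →
  sum (map (λ x → f x + g x) xs) ≡ sum (map f xs) + sum (map g xs)
sum-map-+ f g []       = refl
sum-map-+ f g (x ∷ xs) =
  trans (cong (f x + g x +_) (sum-map-+ f g xs)) (interchange (f x) (g x) _ _)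

sum-map-swap : (f : A → B → ℕ) (xs : List A) (ys : List B) →
  sum (map (λ x → sum (map (f x) ys)) xs) ≡ sum (map (λ y → sum (map (λ x → f x y) xs)) ys)
sum-map-swap f []       ys = sym (sum-map-zero ys)
sum-map-swap f (x ∷ xs) ys =
  trans (cong (sum (map (f x) ys) +_) (sum-map-swap f xs ys)) (sym (sum-map-+ (f x) _ ys))

*-if : (c : ℕ) (b : Bool) (x : ℕ) → c * (if b then x else 0) ≡ (if b then c * x else 0)
*-if c true  x = refl
*-if c false x = *-zeroʳ c

if-∧ : (b c : Bool) (x : ℕ) → (if b ∧ c then x else 0) ≡ (if b then (if c then x else 0) else 0)
if-∧ true  c x = refl
if-∧ false c x = refl

if-cong : (b : Bool) {x y : ℕ} → (b ≡ true → x ≡ y) → (if b then x else 0) ≡ (if b then y else 0)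
if-cong true  x≡y = x≡y refl
if-cong false x≡y = refl

countB≡sum : (p : A → Bool) (xs : List A) → countB p xs ≡ sum (map (λ x → if p x then 1 else 0) xs)
countB≡sum p []       = refl
countB≡sum p (x ∷ xs) = cong (_ +_) (countB≡sum p xs)

countB-cong : {p q : A → Bool} → (∀ x → p x ≡ q x) → (xs : List A) → countB p xs ≡ countB q xs
countB-cong p≗q []       = refl
countB-cong p≗q (x ∷ xs) = cong₂ (λ b n → (if b then 1 else 0) + n) (p≗q x) (countB-cong p≗q xs)

countB-map : (p : B → Bool) (g : A → B) (xs : List A) → countB p (map g xs) ≡ countB (p ∘ g) xs
countB-map p g []       = refl
countB-map p g (x ∷ xs) = cong (_ +_) (countB-map p g xs)

countB-concatMap : (p : B → Bool) (f : A → List B) (xs : List A) →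
  countB p (concatMap f xs) ≡ sum (map (λ x → countB p (f x)) xs)
countB-concatMap p f xs = begin
  countB p (concatMap f xs)                                   ≡⟨ countB≡sum p (concatMap f xs) ⟩
  sum (map 𝟙 (concatMap f xs))                                ≡⟨ sum-map-concatMap 𝟙 f xs ⟩
  sum (map (λ x → sum (map 𝟙 (f x))) xs)                      ≡⟨ cong sum (map-cong (λ x → sym (countB≡sum p (f x))) xs) ⟩
  sum (map (λ x → countB p (f x)) xs)                         ∎
  where 𝟙 = λ y → if p y then 1 else 0

countB-guard : (b : Bool) (p : A → Bool) (xs : List A) → countB (λ x → b ∧ p x) xs ≡ (if b then countB p xs else 0)
countB-guard true  p xs = refl
countB-guard false p []       = refl
countB-guard false p (x ∷ xs) = countB-guard false p xs

countB-seqs-suc : (p : List A → Bool) (xs : List A) (m : ℕ) →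
  countB p (seqs xs (suc m)) ≡ sum (map (λ x → countB (λ w → p (x ∷ w)) (seqs xs m)) xs)
countB-seqs-suc p xs m =
  trans (countB-concatMap p _ xs) (cong sum (map-cong (λ x → countB-map p (x ∷_) (seqs xs m)) xs))

∑< : ℕ → (ℕ → ℕ) → ℕ
∑< K f = sum (applyUpTo f K)

syntax ∑< K (λ j → f) = ∑[ j < K ] f

sum-upTo : (f : ℕ → ℕ) (K : ℕ) → sum (map f (upTo K)) ≡ ∑[ j < K ] f j
sum-upTo f K = cong sum (map-upTo f K)

sum-upTo-suc : (f : ℕ → ℕ) (K : ℕ) → sum (map f (upTo (suc K))) ≡ f 0 + ∑[ j < K ] f (suc j)
sum-upTo-suc f K = sum-upTo f (suc K)

∑-cong : (K : ℕ) {f g : ℕ → ℕ} → (∀ j → j < K → f j ≡ g j) → ∑< K f ≡ ∑< K g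
∑-cong zero    f≗g = refl
∑-cong (suc K) f≗g = cong₂ _+_ (f≗g 0 z<s) (∑-cong K (λ j j<K → f≗g (suc j) (s<s j<K)))

∑-+ : (K : ℕ) (f g : ℕ → ℕ) → ∑[ j < K ] (f j + g j) ≡ ∑< K f + ∑< K g
∑-+ K f g = trans (sym (sum-upTo _ K)) (trans (sum-map-+ f g (upTo K)) (cong₂ _+_ (sum-upTo f K) (sum-upTo g K)))

∑-* : (K c : ℕ) (f : ℕ → ℕ) → ∑[ j < K ] (c * f j) ≡ c * ∑< K f
∑-* K c f = trans (sym (sum-upTo _ K)) (trans (sum-map-* c f (upTo K)) (cong (c *_) (sum-upTo f K)))

-- The order on T∞

above : ℕ → Bool → ℕ → Bool
above v tie j = (v <ᵇ j) ∨ ((v ≡ᵇ j) ∧ tie)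

∑-above : (K v : ℕ) (tie : Bool) (f : ℕ → ℕ) → v < K →
  ∑[ j < K ] (if above v tie j then f j else 0) ≡ (if tie then f v else 0) + ∑[ j < K ] (if v <ᵇ j then f j else 0)
∑-above (suc K) zero    tie f v<K       = refl
∑-above (suc K) (suc v) tie f (s<s v<K) = ∑-above K v tie (f ∘ suc) v<K

∑-above-pair : (K v : ℕ) (α β : Bool) (f g : ℕ → ℕ) → v < K →
  ∑[ j < K ] ((if above v α j then f j else 0) + (if above v β j then g j else 0))
    ≡ (if α then f v else 0) + (if β then g v else 0) + ∑[ j < K ] (if v <ᵇ j then f j + g j else 0)
∑-above-pair K v α β f g v<K = begin
  ∑[ j < K ] (F j + G j)                       ≡⟨ ∑-+ K F G ⟩
  ∑< K F + ∑< K G                              ≡⟨ cong₂ _+_ (∑-above K v α f v<K) (∑-above K v β g v<K) ⟩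
  (f₀ + ∑< K F′) + (g₀ + ∑< K G′)              ≡⟨ interchange f₀ _ g₀ _ ⟩
  f₀ + g₀ + (∑< K F′ + ∑< K G′)                ≡⟨ cong (f₀ + g₀ +_) (sym (∑-+ K F′ G′)) ⟩
  f₀ + g₀ + ∑[ j < K ] (F′ j + G′ j)           ≡⟨ cong (f₀ + g₀ +_) (∑-cong K (λ j _ → if-+ (v <ᵇ j))) ⟩
  f₀ + g₀ + ∑[ j < K ] (if v <ᵇ j then f j + g j else 0) ∎
  where
  F  = λ j → if above v α j then f j else 0
  G  = λ j → if above v β j then g j else 0
  F′ = λ j → if v <ᵇ j then f j else 0
  G′ = λ j → if v <ᵇ j then g j else 0
  f₀ = if α then f v else 0
  g₀ = if β then g v else 0
  if-+ : ∀ {j} b → (if b then f j else 0) + (if b then g j else 0) ≡ (if b then f j + g j else 0)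
  if-+ true  = refl
  if-+ false = refl

double-<ᵇ : ∀ v j → (2 * v <ᵇ 2 * j) ≡ (v <ᵇ j)
double-<ᵇ v       zero    = refl
double-<ᵇ zero    (suc j) = refl
double-<ᵇ (suc v) (suc j) rewrite +-suc v (v + 0) | +-suc j (j + 0) = double-<ᵇ v j

odd-<ᵇ-double : ∀ v j → (suc (2 * v) <ᵇ 2 * j) ≡ (v <ᵇ j)
odd-<ᵇ-double v       zero    = refl
odd-<ᵇ-double zero    (suc j) rewrite +-suc j (j + 0) = refl
odd-<ᵇ-double (suc v) (suc j) rewrite +-suc v (v + 0) | +-suc j (j + 0) = odd-<ᵇ-double v j

double-<ᵇ-odd : ∀ v j → (2 * v <ᵇ suc (2 * j)) ≡ (v <ᵇ j) ∨ (v ≡ᵇ j)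
double-<ᵇ-odd zero    zero    = refl
double-<ᵇ-odd zero    (suc j) = refl
double-<ᵇ-odd (suc v) zero    = refl
double-<ᵇ-odd (suc v) (suc j) rewrite +-suc v (v + 0) | +-suc j (j + 0) = double-<ᵇ-odd v j

step : Bool → T → T → Bool
step δ x y = if δ then x ≤⁻ y else x ≤⁺ y

step-t0-t0 : ∀ δ → step δ t0 t0 ≡ not δ
step-t0-t0 true  = refl
step-t0-t0 false = refl

step-t0-tneg : ∀ δ j → step δ t0 (tneg j) ≡ true
step-t0-tneg true  j = refl
step-t0-tneg false j = refl

step-t0-tpos : ∀ δ j → step δ t0 (tpos j) ≡ true
step-t0-tpos true  j = refl
step-t0-tpos false j = refl

step-tneg-t0 : ∀ δ v → step δ (tneg v) t0 ≡ false
step-tneg-t0 true  v = refl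
step-tneg-t0 false v = refl

step-tpos-t0 : ∀ δ v → step δ (tpos v) t0 ≡ false
step-tpos-t0 true  v = refl
step-tpos-t0 false v = refl

step-tneg-tneg : ∀ δ v j → step δ (tneg v) (tneg j) ≡ above v δ j
step-tneg-tneg true  v j = cong (_∨ ((v ≡ᵇ j) ∧ true)) (double-<ᵇ v j)
step-tneg-tneg false v j = cong (_∨ ((v ≡ᵇ j) ∧ false)) (double-<ᵇ v j)

step-tpos-tpos : ∀ δ v j → step δ (tpos v) (tpos j) ≡ above v (not δ) j
step-tpos-tpos true  v j = cong (_∨ ((v ≡ᵇ j) ∧ false)) (double-<ᵇ v j)
step-tpos-tpos false v j = cong (_∨ ((v ≡ᵇ j) ∧ true)) (double-<ᵇ v j)

step-tneg-tpos : ∀ δ v j → step δ (tneg v) (tpos j) ≡ above v true j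
step-tneg-tpos δ v j = begin
  step δ (tneg v) (tpos j)         ≡⟨ lemma δ ⟩
  2 * v <ᵇ suc (2 * j)             ≡⟨ double-<ᵇ-odd v j ⟩
  (v <ᵇ j) ∨ (v ≡ᵇ j)              ≡⟨ cong ((v <ᵇ j) ∨_) (sym (∧-identityʳ _)) ⟩
  above v true j                   ∎
  where
  lemma : ∀ δ → step δ (tneg v) (tpos j) ≡ (2 * v <ᵇ suc (2 * j))
  lemma true  = ∨-identityʳ _
  lemma false = ∨-identityʳ _

step-tpos-tneg : ∀ δ v j → step δ (tpos v) (tneg j) ≡ above v false j
step-tpos-tneg δ v j = begin
  step δ (tpos v) (tneg j)         ≡⟨ lemma δ ⟩
  suc (2 * v) <ᵇ 2 * j             ≡⟨ odd-<ᵇ-double v j ⟩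
  v <ᵇ j                           ≡⟨ sym (∨-identityʳ _) ⟩
  (v <ᵇ j) ∨ false                 ≡⟨ cong ((v <ᵇ j) ∨_) (sym (∧-zeroʳ _)) ⟩
  above v false j                  ∎
  where
  lemma : ∀ δ → step δ (tpos v) (tneg j) ≡ (suc (2 * v) <ᵇ 2 * j)
  lemma true  = ∨-identityʳ _
  lemma false = ∨-identityʳ _

sum-Tupto : (F : T → ℕ) (K : ℕ) → sum (map F (Tupto K)) ≡ F t0 + ∑[ j < K ] (F (tneg j) + F (tpos j))
sum-Tupto F K = cong (F t0 +_) (begin
  sum (map F (concatMap (λ j → tneg j ∷ tpos j ∷ []) (upTo K)))  ≡⟨ sum-map-concatMap F _ (upTo K) ⟩
  sum (map (λ j → F (tneg j) + (F (tpos j) + 0)) (upTo K))        ≡⟨ sum-upTo _ K ⟩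
  ∑[ j < K ] (F (tneg j) + (F (tpos j) + 0))                      ≡⟨ ∑-cong K (λ j _ → cong (F (tneg j) +_) (+-identityʳ _)) ⟩
  ∑[ j < K ] (F (tneg j) + F (tpos j))                            ∎)

-- Subsets and the monomials of N_E

sum-allSubsets-suc : (f : Vec Bool (suc m) → ℕ) →
  sum (map f (allSubsets (suc m))) ≡ sum (map (f ∘ (true ∷_)) (allSubsets m)) + sum (map (f ∘ (false ∷_)) (allSubsets m))
sum-allSubsets-suc {m} f =
  trans (sum-map-concatMap f (λ b → map (b ∷_) (allSubsets m)) (true ∷ false ∷ []))
        (cong₂ _+_ (cong sum (sym (map-∘ (allSubsets m))))
                   (trans (+-identityʳ _) (cong sum (sym (map-∘ (allSubsets m))))))

upTo-suc : ∀ m → upTo (suc m) ≡ 0 ∷ map suc (upTo m)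
upTo-suc m = cong (0 ∷_) (sym (map-applyUpTo (λ k → k) suc m))

filterᵇ-map-suc : (p : ℕ → Bool) (xs : List ℕ) → filterᵇ p (map suc xs) ≡ map suc (filterᵇ (p ∘ suc) xs)
filterᵇ-map-suc p []       = refl
filterᵇ-map-suc p (x ∷ xs) with p (suc x)
... | true  = cong (suc x ∷_) (filterᵇ-map-suc p xs)
... | false = filterᵇ-map-suc p xs

sizeE-∷ : (b : Bool) (bs : Vec Bool m) → sizeE (b ∷ bs) ≡ (if b then 1 else 0) + sizeE bs
sizeE-∷ {m} b bs =
  trans (cong (countB (memE (b ∷ bs))) (upTo-suc m)) (cong (_ +_) (countB-map (memE (b ∷ bs)) suc (upTo m)))

elemsE-∷ : (b : Bool) (bs : Vec Bool m) →
  elemsE (b ∷ bs) ≡ (if b then 0 ∷ map suc (elemsE bs) else map suc (elemsE bs))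
elemsE-∷ {m} true  bs =
  trans (cong (filterᵇ (memE (true ∷ bs))) (upTo-suc m)) (cong (0 ∷_) (filterᵇ-map-suc _ (upTo m)))
elemsE-∷ {m} false bs =
  trans (cong (filterᵇ (memE (false ∷ bs))) (upTo-suc m)) (filterᵇ-map-suc _ (upTo m))

-- termN with z₀ replaced by z_v, so that it can describe the tail of a monomial
termNFrom : ℕ → ℕ → List ℕ → List ℕ → List ℕ
termNFrom v n []       is = replicate n v
termNFrom v n (s ∷ ss) is = replicate s v ++ blocks (s ∷ ss) is n

termN≡termNFrom : ∀ n ss is → termN n ss is ≡ termNFrom 0 n ss is
termN≡termNFrom n []       is = refl
termN≡termNFrom n (s ∷ ss) is = refl

blocks-suc : ∀ ss is n → blocks (map suc ss) is (suc n) ≡ blocks ss is n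
blocks-suc []            is       n = refl
blocks-suc (s ∷ [])      []       n = refl
blocks-suc (s ∷ [])      (i ∷ is) n = refl
blocks-suc (s ∷ s′ ∷ ss) []       n = refl
blocks-suc (s ∷ s′ ∷ ss) (i ∷ is) n = cong (replicate (s′ ℕ.∸ s) i ++_) (blocks-suc (s′ ∷ ss) is n)

termNFrom-skip : ∀ v n ss is → termNFrom v (suc n) (map suc ss) is ≡ v ∷ termNFrom v n ss is
termNFrom-skip v n []       is = refl
termNFrom-skip v n (s ∷ ss) is = cong (λ w → v ∷ (replicate s v ++ w)) (blocks-suc (s ∷ ss) is n)

termNFrom-jump : ∀ v i n ss is → termNFrom v (suc n) (0 ∷ map suc ss) (i ∷ is) ≡ i ∷ termNFrom i n ss is
termNFrom-jump v i n []       is = refl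
termNFrom-jump v i n (s ∷ ss) is = cong (λ w → i ∷ (replicate s i ++ w)) (blocks-suc (s ∷ ss) is n)

countN : (K v m : ℕ) → List ℕ → (List ℕ → Bool) → ℕ
countN K v m ss Q = countB (λ is → strictIncPos v is ∧ Q (termNFrom v m ss is)) (seqs (upTo (suc K)) (length ss))

coeffN≡countN : ∀ n ss K e → coeffN n ss K e ≡ countN K 0 n ss (λ w → expo K w ≡V e)
coeffN≡countN n ss K e =
  countB-cong (λ is → cong (λ w → strictIncPos 0 is ∧ (expo K w ≡V e)) (termN≡termNFrom n ss is))
              (seqs (upTo (suc K)) (length ss))

countN-skip : ∀ K v m ss Q → countN K v (suc m) (map suc ss) Q ≡ countN K v m ss (λ w → Q (v ∷ w))
countN-skip K v m ss Q =
  trans (cong (λ l → countB p (seqs M l)) (length-map suc ss))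
        (countB-cong (λ is → cong (λ w → strictIncPos v is ∧ Q w) (termNFrom-skip v m ss is)) (seqs M (length ss)))
  where
  M = upTo (suc K)
  p = λ is → strictIncPos v is ∧ Q (termNFrom v (suc m) (map suc ss) is)

countN-jump : ∀ K v m ss Q → countN K v (suc m) (0 ∷ map suc ss) Q
  ≡ sum (map (λ i → if v <ᵇ i then countN K i m ss (λ w → Q (i ∷ w)) else 0) (upTo (suc K)))
countN-jump K v m ss Q = begin
  countB p (seqs M (suc (length (map suc ss))))
    ≡⟨ cong (λ l → countB p (seqs M (suc l))) (length-map suc ss) ⟩
  countB p (seqs M (suc (length ss)))
    ≡⟨ countB-seqs-suc p M (length ss) ⟩
  sum (map (λ i → countB (λ is → p (i ∷ is)) (seqs M (length ss))) M)
    ≡⟨ cong sum (map-cong first-index M) ⟩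
  sum (map (λ i → if v <ᵇ i then countN K i m ss (λ w → Q (i ∷ w)) else 0) M) ∎
  where
  M = upTo (suc K)
  p = λ is → strictIncPos v is ∧ Q (termNFrom v (suc m) (0 ∷ map suc ss) is)
  first-index : ∀ i → countB (λ is → p (i ∷ is)) (seqs M (length ss))
                      ≡ (if v <ᵇ i then countN K i m ss (λ w → Q (i ∷ w)) else 0)
  first-index i =
    trans (countB-cong (λ is → trans (cong (λ w → ((v <ᵇ i) ∧ strictIncPos i is) ∧ Q w) (termNFrom-jump v i m ss is))
                                      (∧-assoc (v <ᵇ i) _ _)) (seqs M (length ss)))
          (countB-guard (v <ᵇ i) (λ is → strictIncPos i is ∧ Q (i ∷ termNFrom i m ss is)) (seqs M (length ss)))

-- Peaks and the subsets E

exposedAfter : Bool → Bool → Bool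
exposedAfter descent true  = false
exposedAfter descent false = not descent

-- d is the descent indicator and E ⊆ {s, s+1, …}. The flag `exposed` records
-- that s − 1 is an ascent (or s = 0) and lies outside E, so that a descent at
-- s would be a peak not covered by E ∪ (E + 1).
coversPeaks : (ℕ → Bool) → Bool → ℕ → Vec Bool m → Bool
coversPeaks d exposed s []       = true
coversPeaks d exposed s (b ∷ bs) = (b ∨ not (exposed ∧ d s)) ∧ coversPeaks d (exposedAfter (d s) b) (suc s) bs

peak-covered : ∀ x y b c → not (not x ∧ y) ∨ c ∨ b ≡ c ∨ not (exposedAfter x b ∧ y)
peak-covered true  y     true  true  = refl
peak-covered true  y     true  false = refl
peak-covered true  y     false true  = refl
peak-covered true  y     false false = refl
peak-covered false false true  true  = refl
peak-covered false false true  false = refl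
peak-covered false false false true  = refl
peak-covered false false false false = refl
peak-covered false true  true  c     = refl
peak-covered false true  false c     = refl

and-peaks : (d P : ℕ → Bool) (bs : Vec Bool m) (b : Bool) (s : ℕ) →
  (∀ k → k < m → P k ≡ not (d (k + s)) ∧ d (suc (k + s))) →
  and (applyUpTo (λ k → not (P k) ∨ memE bs k ∨ memE (b ∷ bs) k) m) ≡ coversPeaks d (exposedAfter (d s) b) (suc s) bs
and-peaks d P []       b s peaks = refl
and-peaks d P (c ∷ cs) b s peaks =
  cong₂ _∧_ (trans (cong (λ p → not p ∨ c ∨ b) (peaks 0 z<s)) (peak-covered (d s) (d (suc s)) b c))
            (and-peaks d (P ∘ suc) cs c (suc s)
              (λ k k<m → trans (peaks (suc k) (s<s k<m)) (cong (λ t → not (d t) ∧ d (suc t)) (sym (+-suc k s)))))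

module SubsetSum (d : ℕ → Bool) (K : ℕ) where

  subsetSum : Bool → ℕ → ℕ → (m : ℕ) → (List ℕ → Bool) → ℕ
  subsetSum exposed v s m Q =
    sum (map (λ E → if coversPeaks d exposed s E then 2 ^ sizeE E * countN K v m (elemsE E) Q else 0) (allSubsets m))

  jumpSum : ℕ → ℕ → ℕ → (List ℕ → Bool) → ℕ
  jumpSum v s m Q = sum (map (λ i → if v <ᵇ i then subsetSum false i (suc s) m (λ w → Q (i ∷ w)) else 0) (upTo (suc K)))

  subsetSum-zero : ∀ exposed v s Q → subsetSum exposed v s 0 Q ≡ (if Q [] then 1 else 0)
  subsetSum-zero exposed v s Q = trans (+-identityʳ _) (trans (+-identityʳ _) (+-identityʳ _))

  subsetSum-suc : ∀ exposed v s m Q → subsetSum exposed v s (suc m) Q ≡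
      (if not (exposed ∧ d s) then subsetSum (not (d s)) v (suc s) m (λ w → Q (v ∷ w)) else 0)
    + 2 * jumpSum v s m Q
  subsetSum-suc exposed v s m Q =
    trans (sum-allSubsets-suc G)
          (trans (+-comm (sum (map (G ∘ (true ∷_)) Es)) (sum (map (G ∘ (false ∷_)) Es))) (cong₂ _+_ s∉E s∈E))
    where
    Es = allSubsets m
    M = upTo (suc K)
    G : Vec Bool (suc m) → ℕ
    G E = if coversPeaks d exposed s E then 2 ^ sizeE E * countN K v (suc m) (elemsE E) Q else 0

    s∉E : sum (map (G ∘ (false ∷_)) Es)
          ≡ (if not (exposed ∧ d s) then subsetSum (not (d s)) v (suc s) m (λ w → Q (v ∷ w)) else 0)
    s∉E = trans (cong sum (map-cong skip Es)) (sum-map-if (not (exposed ∧ d s)) _ Es)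
      where
      skip : ∀ bs → G (false ∷ bs) ≡ (if not (exposed ∧ d s) then
                      (if coversPeaks d (not (d s)) (suc s) bs then 2 ^ sizeE bs * countN K v m (elemsE bs) (λ w → Q (v ∷ w)) else 0)
                    else 0)
      skip bs = trans (cong₂ (λ k c → if not (exposed ∧ d s) ∧ covered then 2 ^ k * c else 0) (sizeE-∷ false bs)
                        (trans (cong (λ ss → countN K v (suc m) ss Q) (elemsE-∷ false bs)) (countN-skip K v m (elemsE bs) Q)))
                      (if-∧ (not (exposed ∧ d s)) covered _)
        where covered = coversPeaks d (not (d s)) (suc s) bs

    f : Vec Bool m → ℕ → ℕ
    f bs i = if v <ᵇ i then (if coversPeaks d false (suc s) bs then 2 ^ sizeE bs * countN K i m (elemsE bs) (λ w → Q (i ∷ w)) else 0) else 0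

    jump : ∀ bs → G (true ∷ bs) ≡ 2 * sum (map (f bs) M)
    jump bs = trans (cong₂ (λ k c → if coversPeaks d false (suc s) bs then 2 ^ k * c else 0) (sizeE-∷ true bs)
                      (trans (cong (λ ss → countN K v (suc m) ss Q) (elemsE-∷ true bs)) (countN-jump K v m (elemsE bs) Q)))
                    (factor (coversPeaks d false (suc s) bs))
      where
      factor : ∀ c → (if c then 2 ^ suc (sizeE bs) * sum (map (λ i → if v <ᵇ i then countN K i m (elemsE bs) (λ w → Q (i ∷ w)) else 0) M) else 0)
                     ≡ 2 * sum (map (λ i → if v <ᵇ i then (if c then 2 ^ sizeE bs * countN K i m (elemsE bs) (λ w → Q (i ∷ w)) else 0) else 0) M)
      factor true  = trans (*-assoc 2 (2 ^ sizeE bs) _)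
                       (cong (2 *_) (trans (sym (sum-map-* (2 ^ sizeE bs) _ M)) (cong sum (map-cong (λ i → *-if (2 ^ sizeE bs) (v <ᵇ i) _) M))))
      factor false = sym (trans (cong (2 *_) (trans (cong sum (map-cong (λ i → if-zero (v <ᵇ i)) M)) (sum-map-zero M))) (*-zeroʳ 2))
        where
        if-zero : ∀ b → (if b then 0 else 0) ≡ 0
        if-zero true  = refl
        if-zero false = refl

    s∈E : sum (map (G ∘ (true ∷_)) Es)
          ≡ 2 * sum (map (λ i → if v <ᵇ i then subsetSum false i (suc s) m (λ w → Q (i ∷ w)) else 0) M)
    s∈E = begin
      sum (map (G ∘ (true ∷_)) Es)                               ≡⟨ cong sum (map-cong jump Es) ⟩
      sum (map (λ bs → 2 * sum (map (f bs) M)) Es)              ≡⟨ sum-map-* 2 _ Es ⟩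
      2 * sum (map (λ bs → sum (map (f bs) M)) Es)              ≡⟨ cong (2 *_) (sum-map-swap f Es M) ⟩
      2 * sum (map (λ i → sum (map (λ bs → f bs i) Es)) M)      ≡⟨ cong (2 *_) (cong sum (map-cong (λ i → sum-map-if (v <ᵇ i) _ Es) M)) ⟩
      2 * sum (map (λ i → if v <ᵇ i then subsetSum false i (suc s) m (λ w → Q (i ∷ w)) else 0) M) ∎

<ℤ-flip : ∀ x y → x ≢ y → (x <ℤ y) ≡ not (y <ℤ x)
<ℤ-flip x y x≢y with ℤ.<-cmp x y
... | tri< x<y _ y≮x rewrite dec-true (x ℤ.<? y) x<y | dec-false (y ℤ.<? x) y≮x = refl
... | tri≈ _ x≡y _   = ⊥-elim (x≢y x≡y)
... | tri> x≮y _ y<x rewrite dec-false (x ℤ.<? y) x≮y | dec-true (y ℤ.<? x) y<x = refl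

module _ {n : ℕ} (π : SignedPerm n) where

  πval-suc : ∀ k (k<n : k < n) → πval π (suc k) ≡ img π (fromℕ< k<n)
  πval-suc k k<n with k ℕ.<? n
  ... | yes _   = refl
  ... | no  k≮n  = ⊥-elim (k≮n k<n)

  img≢0 : ∀ i → img π i ≢ ℤ.0ℤ
  img≢0 i i↦0 = 1+n≰n (subst (λ z → 1 ≤ ∣ z ∣) i↦0 (abs-pos π i))

  πval-suc-distinct : ∀ k → suc k < n → πval π k ≢ πval π (suc k)
  πval-suc-distinct zero    1<n eq = img≢0 _ (sym (trans eq (πval-suc 0 (<-trans z<s 1<n))))
  πval-suc-distinct (suc k) k+2<n eq = 1+n≢n (sym (begin
    k                       ≡⟨ toℕ-fromℕ< k<n ⟨
    toℕ (fromℕ< k<n)        ≡⟨ cong toℕ (abs-inj π _ _ (cong ∣_∣ images)) ⟩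
    toℕ (fromℕ< k+1<n)      ≡⟨ toℕ-fromℕ< k+1<n ⟩
    suc k                   ∎))
    where
    k+1<n  = <-trans (n<1+n (suc k)) k+2<n
    k<n    = <-trans (n<1+n k) k+1<n
    images = trans (sym (πval-suc k k<n)) (trans eq (πval-suc (suc k) k+1<n))

  peB-suc : ∀ k → suc k < n → peB π (suc k) ≡ not (desB π k) ∧ desB π (suc k)
  peB-suc k k+1<n =
    peak-shape (Equivalence.to T-≡ (<⇒<ᵇ k+1<n)) (Equivalence.to T-≡ (<⇒<ᵇ (<-trans (n<1+n k) k+1<n)))
               (<ℤ-flip (πval π k) (πval π (suc k)) (πval-suc-distinct k k+1<n))
    where
    peak-shape : ∀ {a b x y z} → a ≡ true → b ≡ true → x ≡ not y → a ∧ x ∧ z ≡ not (b ∧ y) ∧ (a ∧ z)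
    peak-shape refl refl x≡¬y = cong (_∧ _) x≡¬y

admissible≡coversPeaks : ∀ {n′} (π : SignedPerm (suc n′)) (E : Vec Bool (suc n′)) →
  admissible π E ≡ coversPeaks (desB π) true 0 E
admissible≡coversPeaks {n′} π (b ∷ bs) =
  trans (∧-comm (and (map covered (applyUpTo suc n′))) (not (desB π 0) ∨ b))
        (cong₂ _∧_ (∨-comm (not (desB π 0)) b)
                   (trans (cong and (map-applyUpTo suc covered n′)) (and-peaks (desB π) (peB π ∘ suc) bs b 0 peaks)))
  where
  covered = λ i → not (peB π i) ∨ memE (b ∷ bs) i ∨ memE (b ∷ bs) (i ℕ.∸ 1)
  peaks : ∀ k → k < n′ → peB π (suc k) ≡ not (desB π (k + 0)) ∧ desB π (suc (k + 0))
  peaks k k<n′ = trans (peB-suc π k (s<s k<n′)) (cong (λ t → not (desB π t) ∧ desB π (suc t)) (sym (+-identityʳ k)))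

-- Counting words

double : ∀ x → x + x ≡ 2 * x
double x = cong (x +_) (sym (+-identityʳ x))

module Words {n : ℕ} (π : SignedPerm n) (K : ℕ) where

  countWords : T → ℕ → ℕ → (List ℕ → Bool) → ℕ
  countWords x s m Q = countB (λ a → validFrom π x s a ∧ Q (map absT a)) (seqs (Tupto K) m)

  after : T → ℕ → ℕ → (List ℕ → Bool) → ℕ
  after y s m Q = countWords y (suc s) m (λ w → Q (absT y ∷ w))

  countWords-zero : ∀ x s Q → countWords x s 0 Q ≡ (if Q [] then 1 else 0)
  countWords-zero x s Q = +-identityʳ _

  countWords-suc : ∀ x s m Q →
    countWords x s (suc m) Q ≡ sum (map (λ y → if step (desB π s) x y then after y s m Q else 0) (Tupto K))
  countWords-suc x s m Q = trans (countB-seqs-suc p (Tupto K) m) (cong sum (map-cong first-letter (Tupto K)))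
    where
    p = λ a → validFrom π x s a ∧ Q (map absT a)
    first-letter : ∀ y → countB (λ w → p (y ∷ w)) (seqs (Tupto K) m) ≡ (if step (desB π s) x y then after y s m Q else 0)
    first-letter y =
      trans (countB-cong (λ w → ∧-assoc (step (desB π s) x y) _ _) (seqs (Tupto K) m))
            (countB-guard _ (λ w → validFrom π y (suc s) w ∧ Q (absT y ∷ map absT w)) (seqs (Tupto K) m))

  countWords-t0-suc : ∀ s m Q → countWords t0 s (suc m) Q
    ≡ (if not (desB π s) then after t0 s m Q else 0) + ∑[ j < K ] (after (tneg j) s m Q + after (tpos j) s m Q)
  countWords-t0-suc s m Q =
    trans (countWords-suc t0 s m Q)
          (trans (sum-Tupto F K)
                 (cong₂ _+_ (cong (λ c → if c then after t0 s m Q else 0) (step-t0-t0 δ))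
                            (∑-cong K (λ j _ → cong₂ _+_ (cong (λ c → if c then after (tneg j) s m Q else 0) (step-t0-tneg δ j))
                                                         (cong (λ c → if c then after (tpos j) s m Q else 0) (step-t0-tpos δ j))))))
    where
    δ = desB π s
    F = λ y → if step δ t0 y then after y s m Q else 0

  countWords-letter-suc : ∀ x v s m Q α β → step (desB π s) x t0 ≡ false →
    (∀ j → step (desB π s) x (tneg j) ≡ above v α j) → (∀ j → step (desB π s) x (tpos j) ≡ above v β j) → v < K →
    countWords x s (suc m) Q
      ≡ (if α then after (tneg v) s m Q else 0) + (if β then after (tpos v) s m Q else 0)
        + ∑[ j < K ] (if v <ᵇ j then after (tneg j) s m Q + after (tpos j) s m Q else 0)
  countWords-letter-suc x v s m Q α β ↛t0 ↛tneg ↛tpos v<K = begin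
    countWords x s (suc m) Q
      ≡⟨ countWords-suc x s m Q ⟩
    sum (map F (Tupto K))
      ≡⟨ sum-Tupto F K ⟩
    F t0 + ∑[ j < K ] (F (tneg j) + F (tpos j))
      ≡⟨ cong₂ _+_ (cong (λ c → if c then after t0 s m Q else 0) ↛t0)
                   (∑-cong K (λ j _ → cong₂ _+_ (cong (λ c → if c then a j else 0) (↛tneg j))
                                                (cong (λ c → if c then b j else 0) (↛tpos j)))) ⟩
    ∑[ j < K ] ((if above v α j then a j else 0) + (if above v β j then b j else 0))
      ≡⟨ ∑-above-pair K v α β a b v<K ⟩
    (if α then a v else 0) + (if β then b v else 0) + ∑[ j < K ] (if v <ᵇ j then a j + b j else 0) ∎
    where
    F = λ y → if step (desB π s) x y then after y s m Q else 0
    a = λ j → after (tneg j) s m Q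
    b = λ j → after (tpos j) s m Q

module Correspondence {n : ℕ} (π : SignedPerm n) (K : ℕ) where
  open Words π K public
  open SubsetSum (desB π) K public

  jumps : ∀ m s w Q →
    (∀ j → j < K → after (tneg j) s m Q + after (tpos j) s m Q ≡ 2 * subsetSum false (suc j) (suc s) m (λ u → Q (suc j ∷ u))) →
    ∑[ j < K ] (if w <ᵇ suc j then after (tneg j) s m Q + after (tpos j) s m Q else 0) ≡ 2 * jumpSum w s m Q
  jumps m s w Q pairs = begin
    ∑[ j < K ] (if w <ᵇ suc j then after (tneg j) s m Q + after (tpos j) s m Q else 0)
      ≡⟨ ∑-cong K (λ j j<K → trans (cong (λ c → if w <ᵇ suc j then c else 0) (pairs j j<K)) (sym (*-if 2 (w <ᵇ suc j) _))) ⟩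
    ∑[ j < K ] (2 * S (suc j))
      ≡⟨ ∑-* K 2 (S ∘ suc) ⟩
    2 * ∑[ j < K ] S (suc j)
      ≡⟨ cong (2 *_) (sym (sum-upTo-suc S K)) ⟩
    2 * jumpSum w s m Q ∎
    where S = λ i → if w <ᵇ i then subsetSum false i (suc s) m (λ u → Q (i ∷ u)) else 0

  mutual
    words-tpos : ∀ m s v Q → v < K → countWords (tpos v) s m Q ≡ subsetSum true (suc v) s m Q
    words-tpos zero    s v Q v<K = trans (countWords-zero (tpos v) s Q) (sym (subsetSum-zero true (suc v) s Q))
    words-tpos (suc m) s v Q v<K = begin
      countWords (tpos v) s (suc m) Q
        ≡⟨ countWords-letter-suc (tpos v) v s m Q false (not δ) (step-tpos-t0 δ v) (step-tpos-tneg δ v) (step-tpos-tpos δ v) v<K ⟩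
      (if not δ then after (tpos v) s m Q else 0) + ∑[ j < K ] (if v <ᵇ j then after (tneg j) s m Q + after (tpos j) s m Q else 0)
        ≡⟨ cong₂ _+_ (if-cong (not δ) (λ ¬δ → trans (words-tpos m (suc s) v Qᵥ v<K) (cong (λ e → subsetSum e (suc v) (suc s) m Qᵥ) (sym ¬δ))))
                     (jumps m s (suc v) Q (λ j → words-pair m (suc s) j (λ u → Q (suc j ∷ u)))) ⟩
      (if not δ then subsetSum (not δ) (suc v) (suc s) m Qᵥ else 0) + 2 * jumpSum (suc v) s m Q
        ≡⟨ subsetSum-suc true (suc v) s m Q ⟨
      subsetSum true (suc v) s (suc m) Q ∎
      where
      δ  = desB π s
      Qᵥ = λ u → Q (suc v ∷ u)

    words-pair : ∀ m s v Q → v < K →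
      countWords (tneg v) s m Q + countWords (tpos v) s m Q ≡ 2 * subsetSum false (suc v) s m Q
    words-pair zero    s v Q v<K =
      trans (cong₂ _+_ (countWords-zero (tneg v) s Q) (countWords-zero (tpos v) s Q))
            (trans (double (if Q [] then 1 else 0)) (cong (2 *_) (sym (subsetSum-zero false (suc v) s Q))))
    words-pair (suc m) s v Q v<K = begin
      countWords (tneg v) s (suc m) Q + countWords (tpos v) s (suc m) Q
        ≡⟨ cong₂ _+_ (countWords-letter-suc (tneg v) v s m Q δ true (step-tneg-t0 δ v) (step-tneg-tneg δ v) (step-tneg-tpos δ v) v<K)
                     (countWords-letter-suc (tpos v) v s m Q false (not δ) (step-tpos-t0 δ v) (step-tpos-tneg δ v) (step-tpos-tpos δ v) v<K) ⟩
      ((if δ then a else 0) + b + L) + ((if not δ then b else 0) + L)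
        ≡⟨ regroup (if δ then a else 0) b (if not δ then b else 0) L ⟩
      ((if δ then a else 0) + b + (if not δ then b else 0)) + 2 * L
        ≡⟨ cong₂ _+_ (repeated-value δ (λ e → subsetSum e (suc v) (suc s) m Qᵥ) (words-pair m (suc s) v Qᵥ v<K) (words-tpos m (suc s) v Qᵥ v<K))
                     (cong (2 *_) (jumps m s (suc v) Q (λ j → words-pair m (suc s) j (λ u → Q (suc j ∷ u))))) ⟩
      2 * subsetSum (not δ) (suc v) (suc s) m Qᵥ + 2 * (2 * jumpSum (suc v) s m Q)
        ≡⟨ *-distribˡ-+ 2 (subsetSum (not δ) (suc v) (suc s) m Qᵥ) (2 * jumpSum (suc v) s m Q) ⟨
      2 * (subsetSum (not δ) (suc v) (suc s) m Qᵥ + 2 * jumpSum (suc v) s m Q)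
        ≡⟨ cong (2 *_) (subsetSum-suc false (suc v) s m Q) ⟨
      2 * subsetSum false (suc v) s (suc m) Q ∎
      where
      δ  = desB π s
      Qᵥ = λ u → Q (suc v ∷ u)
      a  = after (tneg v) s m Q
      b  = after (tpos v) s m Q
      L  = ∑[ j < K ] (if v <ᵇ j then after (tneg j) s m Q + after (tpos j) s m Q else 0)
      regroup : ∀ x y z l → (x + y + l) + (z + l) ≡ (x + y + z) + 2 * l
      regroup = solve-∀
      repeated-value : ∀ δ (r : Bool → ℕ) → a + b ≡ 2 * r false → b ≡ r true →
        (if δ then a else 0) + b + (if not δ then b else 0) ≡ 2 * r (not δ)
      repeated-value true  r pair single = trans (+-identityʳ _) pair
      repeated-value false r pair single = trans (cong₂ _+_ single single) (double (r true))

  words-t0 : ∀ m s Q → countWords t0 s m Q ≡ subsetSum true 0 s m Q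
  words-t0 zero    s Q = trans (countWords-zero t0 s Q) (sym (subsetSum-zero true 0 s Q))
  words-t0 (suc m) s Q = begin
    countWords t0 s (suc m) Q
      ≡⟨ countWords-t0-suc s m Q ⟩
    (if not δ then after t0 s m Q else 0) + ∑[ j < K ] (after (tneg j) s m Q + after (tpos j) s m Q)
      ≡⟨ cong₂ _+_ (if-cong (not δ) (λ ¬δ → trans (words-t0 m (suc s) Q₀) (cong (λ e → subsetSum e 0 (suc s) m Q₀) (sym ¬δ))))
                   (jumps m s 0 Q (λ j → words-pair m (suc s) j (λ u → Q (suc j ∷ u)))) ⟩
    (if not δ then subsetSum (not δ) 0 (suc s) m Q₀ else 0) + 2 * jumpSum 0 s m Q
      ≡⟨ subsetSum-suc true 0 s m Q ⟨
    subsetSum true 0 s (suc m) Q ∎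
    where
    δ  = desB π s
    Q₀ = λ u → Q (0 ∷ u)

theorem6p3 : (n : ℕ) → 1 ≤ n → (π : SignedPerm n) →
    (K : ℕ) (e : Vec ℕ (suc K)) →
    coeffDB π K e
      ≡ sum (map (λ E → if admissible π E then 2 ^ sizeE E * coeffN n (elemsE E) K e else 0)
                 (allSubsets n))
theorem6p3 (suc n′) _ π K e = begin
  coeffDB π K e
    ≡⟨ words-t0 (suc n′) 0 Q ⟩
  subsetSum true 0 0 (suc n′) Q
    ≡⟨ cong sum (map-cong summand (allSubsets (suc n′))) ⟩
  sum (map (λ E → if admissible π E then 2 ^ sizeE E * coeffN (suc n′) (elemsE E) K e else 0) (allSubsets (suc n′))) ∎
  where
  open Correspondence π K
  Q = λ w → expo K w ≡V e
  summand : ∀ E → (if coversPeaks (desB π) true 0 E then 2 ^ sizeE E * countN K 0 (suc n′) (elemsE E) Q else 0)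
                  ≡ (if admissible π E then 2 ^ sizeE E * coeffN (suc n′) (elemsE E) K e else 0)
  summand E = cong₂ (λ c x → if c then 2 ^ sizeE E * x else 0)
                    (sym (admissible≡coversPeaks π E)) (sym (coeffN≡countN (suc n′) (elemsE E) K e))
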